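{- Let $\lambda$ and $\mu$ be partitions with $\lambda \sqsubseteq \mu$ and $|\mu| = |\lambda| + 1$. Then for every $r \ge 1$, \[ 0 \le \sum_{i=1}^r \mu_i - \sum_{i=1}^r \lambda_i \le 1. \]
   Context: A partition $\lambda=(\lambda_1,\ldots,\lambda_k)$ is a weakly decreasing sequence of positive integers (the empty partition is allowed); $|\lambda|=\sum_i\lambda_i$, and $\lambda$ is regarded as extended by trailing zeros (so $\lambda_i=0$ for $i>k$). The conjugate partition $\lambda^*$ is given by $\lambda^*_i = |\{j : \lambda_j \ge i\}|$. For partitions $\lambda,\mu$, $\lambda \trianglelefteq \mu$ means $\sum_{i=1}^k \lambda_i \le \sum_{i=1}^k \mu_i$ for all $k\ge 1$. We write $\lambda \sqsubseteq \mu$ if both $\lambda \trianglelefteq \mu$ and $\lambda^* \trianglelefteq \mu^*$. -}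

module Defs where

open import Data.Nat using (ℕ; zero; suc; _+_; _≤_; _<_; _≥_; _≤ᵇ_)
open import Data.List using (List; []; _∷_; length; filter)
open import Data.Nat.ListAction using (sum)
open import Data.List.Relation.Unary.All using (All)
open import Data.List.Relation.Unary.Linked using (Linked)
open import Data.Nat.Properties using (_≥?_)

IsPartition : List ℕ → Set
IsPartition l = All (λ x → 1 ≤ x) l × Linked _≥_ l
  where open import Data.Product using (_×_)

record Partition : Set where
  constructor mkPartition
  field
    parts   : List ℕ
    isPart  : IsPartition parts
open Partition public

size : Partition → ℕ
size p = sum (parts p)

-- 1-indexed part λ_i, extended by trailing zeros (λ_0 is unused).
partAt : List ℕ → ℕ → ℕ
partAt []       _             = 0
partAt (x ∷ xs) zero          = 0
partAt (x ∷ xs) (suc zero)    = x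
partAt (x ∷ xs) (suc (suc i)) = partAt xs (suc i)

prefixSum : List ℕ → ℕ → ℕ
prefixSum l zero    = 0
prefixSum l (suc k) = prefixSum l k + partAt l (suc k)

conjPart : List ℕ → ℕ → ℕ
conjPart l i = length (filter (λ x → x ≥? i) l)

conjPrefixSum : List ℕ → ℕ → ℕ
conjPrefixSum l zero    = 0
conjPrefixSum l (suc k) = conjPrefixSum l k + conjPart l (suc k)

_⊴_ : Partition → Partition → Set
λ' ⊴ μ = ∀ k → 1 ≤ k → prefixSum (parts λ') k ≤ prefixSum (parts μ) k

_⊴*_ : Partition → Partition → Set
λ' ⊴* μ = ∀ k → 1 ≤ k → conjPrefixSum (parts λ') k ≤ conjPrefixSum (parts μ) k

_⊑_ : Partition → Partition → Set
λ' ⊑ μ = (λ' ⊴ μ) × (λ' ⊴* μ)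
  where open import Data.Product using (_×_)

-- Write k = λ_r. Every prefix of r parts of μ satisfies Σ_{i≤r} μ_i ≤ r k + Σ_j (μ_j − k)₊,
-- with equality for λ because λ is decreasing. Since Σ_j min(k, λ_j) = λ*_1 + ⋯ + λ*_k,
-- dominance of the conjugates together with |μ| = |λ| + 1 gives
-- Σ_j (μ_j − k)₊ ≤ Σ_j (λ_j − k)₊ + 1, and the upper bound follows.
module Submission where

open import Defs
open import Data.Nat using (ℕ; zero; suc; _+_; _*_; _∸_; _⊓_; _≤_; _≥_; z≤n; s≤s)
open import Data.Nat.Properties
open import Data.Nat.ListAction using (sum)
open import Data.Product using (_×_; _,_; proj₂)
open import Data.Sum using (_⊎_; inj₁; inj₂; map₁)
open import Data.List using (List; []; _∷_; length; take; drop; map)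
open import Data.List.Properties using (filter-accept; filter-reject; take-[])
open import Data.List.Relation.Unary.All as All using (All; []; _∷_)
open import Data.List.Relation.Unary.Linked as Linked using (Linked)
open import Data.List.Relation.Unary.Linked.Properties using (Linked⇒All)
open import Algebra.Properties.CommutativeSemigroup +-commutativeSemigroup
  using (interchange; x∙yz≈y∙xz)
open import Function using (flip)
open import Relation.Nullary using (yes; no)
open import Relation.Binary.PropositionalEquality

sumMin : ℕ → List ℕ → ℕ
sumMin k l = sum (map (k ⊓_) l)

sumExcess : ℕ → List ℕ → ℕ
sumExcess k l = sum (map (_∸ k) l)

sum≡sumMin+sumExcess : ∀ k l → sum l ≡ sumMin k l + sumExcess k l
sum≡sumMin+sumExcess k []       = refl
sum≡sumMin+sumExcess k (x ∷ xs) = begin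
  x + sum xs
    ≡⟨ cong₂ _+_ (sym (m⊓n+n∸m≡n k x)) (sum≡sumMin+sumExcess k xs) ⟩
  (k ⊓ x + (x ∸ k)) + (sumMin k xs + sumExcess k xs)
    ≡⟨ interchange (k ⊓ x) (x ∸ k) _ _ ⟩
  (k ⊓ x + sumMin k xs) + ((x ∸ k) + sumExcess k xs)
    ∎
  where open ≡-Reasoning

-- Each part x contributes [x ≥ k + 1] to λ*_{k+1}, and [x ≥ k + 1] + min(k, x) = min(k + 1, x).
conjPart+sumMin≡sumMin-suc : ∀ k l → conjPart l (suc k) + sumMin k l ≡ sumMin (suc k) l
conjPart+sumMin≡sumMin-suc k [] = refl
conjPart+sumMin≡sumMin-suc k (x ∷ xs) with x ≥? suc k
... | yes x≥1+k
  rewrite filter-accept (_≥? suc k) {x} {xs} x≥1+k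
        | m≤n⇒m⊓n≡m x≥1+k | m≤n⇒m⊓n≡m (≤-trans (n≤1+n k) x≥1+k)
  = cong suc (trans (x∙yz≈y∙xz (conjPart xs (suc k)) k _)
                    (cong (k +_) (conjPart+sumMin≡sumMin-suc k xs)))
... | no x≱1+k
  rewrite filter-reject (_≥? suc k) {x} {xs} x≱1+k
        | m≥n⇒m⊓n≡n (≤-pred (≰⇒> x≱1+k)) | m≥n⇒m⊓n≡n (<⇒≤ (≰⇒> x≱1+k))
  = trans (x∙yz≈y∙xz (conjPart xs (suc k)) x _)
          (cong (x +_) (conjPart+sumMin≡sumMin-suc k xs))

conjPrefixSum≡sumMin : ∀ l k → conjPrefixSum l k ≡ sumMin k l
conjPrefixSum≡sumMin l zero = sym (sumMin-zero l)
  where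
  sumMin-zero : ∀ l → sumMin 0 l ≡ 0
  sumMin-zero []       = refl
  sumMin-zero (_ ∷ xs) = sumMin-zero xs
conjPrefixSum≡sumMin l (suc k) = begin
  conjPrefixSum l k + conjPart l (suc k)  ≡⟨ cong (_+ conjPart l (suc k)) (conjPrefixSum≡sumMin l k) ⟩
  sumMin k l + conjPart l (suc k)         ≡⟨ +-comm (sumMin k l) _ ⟩
  conjPart l (suc k) + sumMin k l         ≡⟨ conjPart+sumMin≡sumMin-suc k l ⟩
  sumMin (suc k) l                        ∎
  where open ≡-Reasoning

⊴*⇒sumMin≤ : ∀ {λ' μ} → λ' ⊴* μ → ∀ k → sumMin k (parts λ') ≤ sumMin k (parts μ)
⊴*⇒sumMin≤ {λ'} {μ} λ*⊴μ* k =
  subst₂ _≤_ (conjPrefixSum≡sumMin (parts λ') k) (conjPrefixSum≡sumMin (parts μ) k) (dominates k)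
  where
  dominates : ∀ k → conjPrefixSum (parts λ') k ≤ conjPrefixSum (parts μ) k
  dominates zero    = z≤n
  dominates (suc k) = λ*⊴μ* (suc k) (s≤s z≤n)

sumExcess≤sumExcess+1 : ∀ {λ' μ} → λ' ⊴* μ → size μ ≡ size λ' + 1 →
                        ∀ k → sumExcess k (parts μ) ≤ sumExcess k (parts λ') + 1
sumExcess≤sumExcess+1 {λ'} {μ} λ*⊴μ* |μ|≡|λ|+1 k =
  +-cancelˡ-≤ (sumMin k L) (sumExcess k M) (sumExcess k L + 1) (begin
    sumMin k L + sumExcess k M        ≤⟨ +-monoˡ-≤ (sumExcess k M) (⊴*⇒sumMin≤ {λ'} {μ} λ*⊴μ* k) ⟩
    sumMin k M + sumExcess k M        ≡⟨ sym (sum≡sumMin+sumExcess k M) ⟩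
    sum M                             ≡⟨ |μ|≡|λ|+1 ⟩
    sum L + 1                         ≡⟨ cong (_+ 1) (sum≡sumMin+sumExcess k L) ⟩
    (sumMin k L + sumExcess k L) + 1  ≡⟨ +-assoc (sumMin k L) _ 1 ⟩
    sumMin k L + (sumExcess k L + 1)  ∎)
  where
  open ≤-Reasoning
  L = parts λ'
  M = parts μ

prefixSum-∷ : ∀ x xs r → prefixSum (x ∷ xs) (suc r) ≡ x + prefixSum xs r
prefixSum-∷ x xs zero    = +-comm 0 x
prefixSum-∷ x xs (suc r) =
  trans (cong (_+ partAt xs (suc r)) (prefixSum-∷ x xs r)) (+-assoc x (prefixSum xs r) _)

prefixSum≡sum-take : ∀ l r → prefixSum l r ≡ sum (take r l)
prefixSum≡sum-take l        zero    = refl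
prefixSum≡sum-take []       (suc r) =
  trans (+-identityʳ _) (trans (prefixSum≡sum-take [] r) (cong sum (take-[] r)))
prefixSum≡sum-take (x ∷ xs) (suc r) =
  trans (prefixSum-∷ x xs r) (cong (x +_) (prefixSum≡sum-take xs r))

sum-take≤ : ∀ k l r → sum (take r l) ≤ r * k + sumExcess k l
sum-take≤ k l        zero    = z≤n
sum-take≤ k []       (suc r) = z≤n
sum-take≤ k (x ∷ xs) (suc r) = begin
  x + sum (take r xs)                       ≤⟨ +-mono-≤ (m≤n+m∸n x k) (sum-take≤ k xs r) ⟩
  (k + (x ∸ k)) + (r * k + sumExcess k xs)  ≡⟨ interchange k (x ∸ k) (r * k) _ ⟩
  (k + r * k) + ((x ∸ k) + sumExcess k xs)  ∎
  where open ≤-Reasoning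

sumExcess≡0 : ∀ {k l} → All (_≤ k) l → sumExcess k l ≡ 0
sumExcess≡0 []                        = refl
sumExcess≡0 (x≤k ∷ xs≤k) rewrite m≤n⇒m∸n≡0 x≤k = sumExcess≡0 xs≤k

-- The alternative k ≡ 0 covers r beyond the length of l, where take r l has fewer than r parts.
sum-take≡ : ∀ k l r → All (k ≤_) (take r l) → All (_≤ k) (drop r l) → r ≤ length l ⊎ k ≡ 0 →
            sum (take r l) ≡ r * k + sumExcess k l
sum-take≡ k  l        zero    _             rest≤k _               = sym (sumExcess≡0 rest≤k)
sum-take≡ k  []       (suc r) _             _      (inj₁ ())
sum-take≡ .0 []       (suc r) _             _      (inj₂ refl)     =
  sym (trans (+-identityʳ (r * 0)) (*-zeroʳ r))
sum-take≡ k  (x ∷ xs) (suc r) (k≤x ∷ k≤xs) rest≤k r≤len⊎k≡0 = begin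
  x + sum (take r xs)
    ≡⟨ cong₂ _+_ (sym (m+[n∸m]≡n k≤x)) (sum-take≡ k xs r k≤xs rest≤k r≤len⊎k≡0′) ⟩
  (k + (x ∸ k)) + (r * k + sumExcess k xs)  ≡⟨ interchange k (x ∸ k) (r * k) _ ⟩
  (k + r * k) + ((x ∸ k) + sumExcess k xs)  ∎
  where
  open ≡-Reasoning
  r≤len⊎k≡0′ : r ≤ length xs ⊎ k ≡ 0
  r≤len⊎k≡0′ = map₁ ≤-pred r≤len⊎k≡0

Decreasing : List ℕ → Set
Decreasing = Linked _≥_

head≥tail : ∀ {x xs} → Decreasing (x ∷ xs) → All (_≤ x) xs
head≥tail d = All.tail (Linked⇒All (flip ≤-trans) ≤-refl d)

partAt≤ : ∀ {x} xs i → All (_≤ x) xs → partAt xs i ≤ x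
partAt≤ []       i             _            = z≤n
partAt≤ (y ∷ ys) zero          _            = z≤n
partAt≤ (y ∷ ys) (suc zero)    (y≤x ∷ _)    = y≤x
partAt≤ (y ∷ ys) (suc (suc i)) (_ ∷ ys≤x)   = partAt≤ ys (suc i) ys≤x

≤-length⊎partAt≡0 : ∀ l r → r ≤ length l ⊎ partAt l r ≡ 0
≤-length⊎partAt≡0 []       r             = inj₂ refl
≤-length⊎partAt≡0 (x ∷ xs) zero          = inj₁ z≤n
≤-length⊎partAt≡0 (x ∷ xs) (suc zero)    = inj₁ (s≤s z≤n)
≤-length⊎partAt≡0 (x ∷ xs) (suc (suc r)) = map₁ s≤s (≤-length⊎partAt≡0 xs (suc r))

All-partAt≤-take : ∀ l r → Decreasing l → All (partAt l r ≤_) (take r l)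
All-partAt≤-take l        zero          _ = []
All-partAt≤-take []       (suc r)       _ = []
All-partAt≤-take (x ∷ xs) (suc zero)    _ = ≤-refl ∷ []
All-partAt≤-take (x ∷ xs) (suc (suc r)) d =
  partAt≤ xs (suc r) (head≥tail d) ∷ All-partAt≤-take xs (suc r) (Linked.tail d)

All-≤partAt-drop : ∀ l r → 1 ≤ r → Decreasing l → All (_≤ partAt l r) (drop r l)
All-≤partAt-drop []       (suc r)       _ _ = []
All-≤partAt-drop (x ∷ xs) (suc zero)    _ d = head≥tail d
All-≤partAt-drop (x ∷ xs) (suc (suc r)) _ d = All-≤partAt-drop xs (suc r) (s≤s z≤n) (Linked.tail d)

sum-take≡partAt : ∀ l r → 1 ≤ r → Decreasing l →
                  sum (take r l) ≡ r * partAt l r + sumExcess (partAt l r) l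
sum-take≡partAt l r r≥1 d =
  sum-take≡ (partAt l r) l r (All-partAt≤-take l r d) (All-≤partAt-drop l r r≥1 d)
            (≤-length⊎partAt≡0 l r)

proposition4 : (λ' μ : Partition) → λ' ⊑ μ → size μ ≡ size λ' + 1 →
    (r : ℕ) → 1 ≤ r →
    (prefixSum (parts λ') r ≤ prefixSum (parts μ) r) ×
    (prefixSum (parts μ) r ≤ prefixSum (parts λ') r + 1)
proposition4 λ' μ (λ⊴μ , λ*⊴μ*) |μ|≡|λ|+1 r r≥1 = λ⊴μ r r≥1 , (begin
  prefixSum M r                   ≡⟨ prefixSum≡sum-take M r ⟩
  sum (take r M)                  ≤⟨ sum-take≤ k M r ⟩
  r * k + sumExcess k M           ≤⟨ +-monoʳ-≤ (r * k) excess-bound ⟩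
  r * k + (sumExcess k L + 1)     ≡⟨ sym (+-assoc (r * k) _ 1) ⟩
  (r * k + sumExcess k L) + 1     ≡⟨ cong (_+ 1) (sym (sum-take≡partAt L r r≥1 L-decreasing)) ⟩
  sum (take r L) + 1              ≡⟨ cong (_+ 1) (sym (prefixSum≡sum-take L r)) ⟩
  prefixSum L r + 1               ∎)
  where
  open ≤-Reasoning
  L = parts λ'
  M = parts μ
  k = partAt L r
  excess-bound : sumExcess k M ≤ sumExcess k L + 1
  excess-bound = sumExcess≤sumExcess+1 {λ'} {μ} λ*⊴μ* |μ|≡|λ|+1 k
  L-decreasing : Decreasing L
  L-decreasing = proj₂ (isPart λ')
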